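{- Let $T$ be a tree of order $n$ whose complement $\overline{T}$ is connected. Then: (1) $PWW(\overline{T})=6$ if and only if $\operatorname{diam}(T)=3$; (2) $PWW(\overline{T})=\dfrac{n^2+3n-4}{2}$ if and only if $\operatorname{diam}(T)>3$.
   Context: $\overline{T}$ is the complement graph on $V(T)$, in which two distinct vertices are adjacent iff they are not adjacent in $T$. For a connected graph $G$, $d(u,v)$ is the shortest-path distance; the eccentricity of $v$ is $\max_u d(u,v)$; the diameter $\operatorname{diam}(G)$ is the maximum eccentricity; a vertex is peripheral if its eccentricity equals the diameter; $\operatorname{Peri}(G)$ is the set of peripheral vertices; $PWW(G)=\frac12\sum_{\{u,v\}\subseteq\operatorname{Peri}(G)}(d(u,v)+d(u,v)^2)$ over unordered pairs of distinct peripheral vertices. -}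

module Defs where

open import Data.Nat using (ℕ; zero; suc; _+_; _*_; _≤_; _<_; _⊔_; _≟_)
open import Data.Nat.Properties using ()
open import Data.Fin using (Fin; zero; suc; inject₁; fromℕ; toℕ)
open import Data.Fin.Properties using () renaming (_<?_ to _<ᶠ?_)
open import Data.List using (List; map; foldr; allFin)
open import Data.Nat.ListAction using (sum)
open import Data.Bool using (Bool; true; false; if_then_else_; _∧_)
open import Data.Product using (Σ; ∃; _×_; _,_)
open import Relation.Nullary using (¬_; does)
open import Relation.Binary.PropositionalEquality using (_≡_; _≢_)
open import Function.Definitions using (Injective)
open import Level using (0ℓ)

record Graph (n : ℕ) : Set₁ where
  field
    Adj    : Fin n → Fin n → Set
    sym    : ∀ {u v} → Adj u v → Adj v u
    irrefl : ∀ {u} → ¬ Adj u u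
open Graph public

complement : ∀ {n} → Graph n → Graph n
complement G = record
  { Adj    = λ u v → (u ≢ v) × ¬ Adj G u v
  ; sym    = λ { (u≢v , ¬a) → (λ e → u≢v (Relation.Binary.PropositionalEquality.sym e))
                            , (λ a → ¬a (Graph.sym G a)) }
  ; irrefl = λ { (u≢u , _) → u≢u Relation.Binary.PropositionalEquality.refl }
  }

data Walk {n : ℕ} (G : Graph n) : Fin n → Fin n → ℕ → Set where
  here : ∀ {u} → Walk G u u 0
  step : ∀ {u w v k} → Adj G u w → Walk G w v k → Walk G u v (suc k)

Connected : ∀ {n} → Graph n → Set
Connected G = ∀ u v → ∃ λ k → Walk G u v k

HasCycle : ∀ {n} → Graph n → Set
HasCycle {n} G =
  Σ ℕ λ k → Σ (Fin (3 + k) → Fin n) λ c →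
    Injective _≡_ _≡_ c
    × (∀ (i : Fin (2 + k)) → Adj G (c (inject₁ i)) (c (suc i)))
    × Adj G (c (fromℕ (2 + k))) (c zero)

Acyclic : ∀ {n} → Graph n → Set
Acyclic G = ¬ HasCycle G

IsTree : ∀ {n} → Graph n → Set
IsTree G = Connected G × Acyclic G

IsDistance : ∀ {n} → Graph n → (Fin n → Fin n → ℕ) → Set
IsDistance G d = ∀ u v → Walk G u v (d u v) × (∀ k → Walk G u v k → d u v ≤ k)

maxOver : ∀ {n} → (Fin n → ℕ) → ℕ
maxOver {n} f = foldr _⊔_ 0 (map f (allFin n))

sumOver : ∀ {n} → (Fin n → ℕ) → ℕ
sumOver {n} f = sum (map f (allFin n))

ecc : ∀ {n} → (Fin n → Fin n → ℕ) → Fin n → ℕ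
ecc d v = maxOver (λ u → d u v)

diam : ∀ {n} → (Fin n → Fin n → ℕ) → ℕ
diam d = maxOver (ecc d)

isPeripheral : ∀ {n} → (Fin n → Fin n → ℕ) → Fin n → Bool
isPeripheral d v = does (ecc d v ≟ diam d)

PWWsum : ∀ {n} → (Fin n → Fin n → ℕ) → ℕ
PWWsum d = sumOver λ u → sumOver λ v →
  if does (u <ᶠ? v) ∧ isPeripheral d u ∧ isPeripheral d v
  then d u v + d u v * d u v else 0

-- PWW = ½ · PWWsum (each term d + d² is even, so the division is exact).
PWW : ∀ {n} → (Fin n → Fin n → ℕ) → ℕ
PWW d = PWWsum d Data.Nat./ 2

-- Call an edge ab of T dominating if every vertex is a, b or a neighbour of a or b.
--
-- If T has a dominating edge ab, the first steps x, y of complement paths a → b and b → a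
-- satisfy x ~ b and y ~ a in T, so y a b x is a path of T and diam T = 3.  In the complement,
-- a x y b is a shortest path, while every other vertex is within distance 2 of everything;
-- hence a and b are the only peripheral vertices and PWW = (3 + 3²)/2 = 6.
--
-- Otherwise every edge uv of T has a vertex w adjacent to neither, so in the complement
-- edges of T are at distance 2 and all other pairs at distance 1.  Then every vertex is
-- peripheral and, T having n − 1 edges, PWW = (C(n,2) − (n − 1))·1 + (n − 1)·3 = (n² + 3n − 4)/2.
-- Applying the same property to an inner edge of a path of length 3 yields two vertices
-- at distance at least 4, so diam T > 3.  Since (n² + 3n − 4)/2 is never 6, both
-- equivalences follow.
--
-- The tree facts used (adjacent vertices differ in depth by one, and every vertex other
-- than the root has a unique parent) come from the absence of a path whose two ends lie
-- at the same depth j and which never rises above depth j: moving both ends to their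
-- parents either closes a cycle or produces such a path at depth j − 1.

module Submission where

open import Defs hiding (sym)
open import Data.Nat using (ℕ; zero; suc; _+_; _*_; _∸_; _/_; _≤_; _<_; _⊔_; z≤n; s≤s; s≤s⁻¹; _≟_)
open import Data.Nat.Properties
open import Data.Nat.DivMod using (/-monoˡ-≤)
open import Data.Nat.ListAction using (sum)
open import Data.Nat.Tactic.RingSolver using (solve; solve-∀)
open import Data.Fin using (Fin; zero; suc; toℕ; inject₁; fromℕ; fromℕ<)
open import Data.Fin.Properties
  using (toℕ-injective; toℕ<n; toℕ-inject₁; toℕ-fromℕ; any?; all?; ¬∀⟶∃¬)
  renaming (_≟_ to _≟ᶠ_; _<?_ to _<ᶠ?_; <-cmp to <ᶠ-cmp; suc-injective to suc-injectiveᶠ)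
open import Data.List using (_∷_; []; foldr; map; tabulate)
open import Data.List.Properties using (map-tabulate)
open import Data.Bool using (true; false; if_then_else_; _∧_)
open import Data.Bool.Properties using (∧-comm; ∧-zeroʳ)
open import Data.Product using (Σ; ∃; ∃₂; _×_; _,_; proj₁; proj₂)
open import Data.Sum using (_⊎_; inj₁; inj₂; [_,_])
import Data.Sum as Sum
open import Data.Empty using (⊥; ⊥-elim)
open import Function using (_∘_; id; flip)
open import Function.Bundles using (_⇔_; mk⇔)
open import Relation.Nullary using (¬_; Dec; yes; no; does)
open import Relation.Nullary.Decidable using (dec-true; dec-false; _×-dec_; _⊎-dec_)
open import Relation.Binary.Definitions using (tri<; tri≈; tri>)
open import Relation.Binary.PropositionalEquality hiding ([_])
open import Algebra.Properties.Semiring.Sum +-*-semiring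
  using (sum-syntax; sum-cong-≗; ∑-distrib-+; ∑-comm; sum-replicate-zero; *-distribˡ-sum)
  renaming (sum to ∑)

𝟙 : ∀ {p} {P : Set p} → Dec P → ℕ
𝟙 (yes _) = 1
𝟙 (no _)  = 0

𝟙-yes : ∀ {p} {P : Set p} (P? : Dec P) → P → 𝟙 P? ≡ 1
𝟙-yes (yes _) _  = refl
𝟙-yes (no ¬p) p  = ⊥-elim (¬p p)

𝟙-no : ∀ {p} {P : Set p} (P? : Dec P) → ¬ P → 𝟙 P? ≡ 0
𝟙-no (yes p) ¬p = ⊥-elim (¬p p)
𝟙-no (no _)  _  = refl

sumOver-suc : ∀ {n} (f : Fin (suc n) → ℕ) → sumOver f ≡ f zero + sumOver (f ∘ suc)
sumOver-suc f = cong (λ xs → f zero + sum xs)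
                     (trans (map-tabulate suc f) (sym (map-tabulate id (f ∘ suc))))

maxOver-suc : ∀ {n} (f : Fin (suc n) → ℕ) → maxOver f ≡ f zero ⊔ maxOver (f ∘ suc)
maxOver-suc f = cong (λ xs → f zero ⊔ foldr _⊔_ 0 xs)
                     (trans (map-tabulate suc f) (sym (map-tabulate id (f ∘ suc))))

sumOver≡∑ : ∀ {n} (f : Fin n → ℕ) → sumOver f ≡ ∑[ i < n ] f i
sumOver≡∑ {zero}  f = refl
sumOver≡∑ {suc n} f = trans (sumOver-suc f) (cong (f zero +_) (sumOver≡∑ (f ∘ suc)))

≤-maxOver : ∀ {n} (f : Fin n → ℕ) i → f i ≤ maxOver f
≤-maxOver f zero    rewrite maxOver-suc f = m≤m⊔n _ _
≤-maxOver f (suc i) rewrite maxOver-suc f = m≤n⇒m≤o⊔n (f zero) (≤-maxOver (f ∘ suc) i)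

maxOver-≤ : ∀ {n} (f : Fin n → ℕ) {c} → (∀ i → f i ≤ c) → maxOver f ≤ c
maxOver-≤ {zero}  f f≤c = z≤n
maxOver-≤ {suc n} f f≤c rewrite maxOver-suc f = ⊔-lub (f≤c zero) (maxOver-≤ (f ∘ suc) (f≤c ∘ suc))

maxOver-attained : ∀ {n} (f : Fin n → ℕ) {c} i → f i ≡ c → (∀ j → f j ≤ c) → maxOver f ≡ c
maxOver-attained f i refl f≤c = ≤-antisym (maxOver-≤ f f≤c) (≤-maxOver f i)

≤-diam : ∀ {n} (d : Fin n → Fin n → ℕ) u v → d u v ≤ diam d
≤-diam d u v = ≤-trans (≤-maxOver (λ w → d w v) u) (≤-maxOver (ecc d) v)

diam-≤ : ∀ {n} (d : Fin n → Fin n → ℕ) {c} → (∀ u v → d u v ≤ c) → diam d ≤ c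
diam-≤ d d≤c = maxOver-≤ (ecc d) (λ v → maxOver-≤ (λ u → d u v) (λ u → d≤c u v))

diam-attained : ∀ {n} (d : Fin n → Fin n → ℕ) {c} u v → d u v ≡ c → (∀ u v → d u v ≤ c) → diam d ≡ c
diam-attained d u v refl d≤c = ≤-antisym (diam-≤ d d≤c) (≤-diam d u v)

∑-const : ∀ n c → ∑[ i < n ] c ≡ n * c
∑-const zero    c = refl
∑-const (suc n) c = cong (c +_) (∑-const n c)

∑-zero : ∀ {n} (f : Fin n → ℕ) → (∀ i → f i ≡ 0) → ∑ f ≡ 0
∑-zero {n} f f≡0 = trans (sum-cong-≗ f≡0) (sum-replicate-zero n)

∑-single : ∀ {n} (f : Fin n → ℕ) c → (∀ i → i ≢ c → f i ≡ 0) → ∑ f ≡ f c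
∑-single f zero    f≡0 =
  trans (cong (f zero +_) (∑-zero (f ∘ suc) (λ i → f≡0 (suc i) λ ()))) (+-identityʳ _)
∑-single f (suc c) f≡0 =
  trans (cong (_+ ∑ (f ∘ suc)) (f≡0 zero λ ()))
        (∑-single (f ∘ suc) c (λ i i≢c → f≡0 (suc i) (i≢c ∘ suc-injectiveᶠ)))

∑-pair : ∀ {n} (f : Fin n → ℕ) {a b} → a ≢ b → (∀ i → i ≢ a → i ≢ b → f i ≡ 0) → ∑ f ≡ f a + f b
∑-pair f {zero}  {zero}  a≢b f≡0 = ⊥-elim (a≢b refl)
∑-pair f {zero}  {suc b} a≢b f≡0 =
  cong (f zero +_) (∑-single (f ∘ suc) b (λ i i≢b → f≡0 (suc i) (λ ()) (i≢b ∘ suc-injectiveᶠ)))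
∑-pair f {suc a} {zero}  a≢b f≡0 =
  trans (cong (f zero +_) (∑-single (f ∘ suc) a (λ i i≢a → f≡0 (suc i) (i≢a ∘ suc-injectiveᶠ) (λ ()))))
        (+-comm (f zero) (f (suc a)))
∑-pair f {suc a} {suc b} a≢b f≡0 =
  trans (cong (_+ ∑ (f ∘ suc)) (f≡0 zero (λ ()) (λ ())))
        (∑-pair (f ∘ suc) (a≢b ∘ cong suc)
                (λ i i≢a i≢b → f≡0 (suc i) (i≢a ∘ suc-injectiveᶠ) (i≢b ∘ suc-injectiveᶠ)))

aboveDiagonal : ∀ {n} → (Fin n → Fin n → ℕ) → Fin n → Fin n → ℕ
aboveDiagonal H u v = if does (u <ᶠ? v) then H u v else 0

∑∑-aboveDiagonal : ∀ {n} (H : Fin n → Fin n → ℕ) → (∀ u v → H u v ≡ H v u) → (∀ u → H u u ≡ 0) →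
  2 * (∑[ u < n ] ∑[ v < n ] aboveDiagonal H u v) ≡ ∑[ u < n ] ∑[ v < n ] H u v
∑∑-aboveDiagonal {n} H H-sym H-diag = sym (begin
  ∑[ u < n ] ∑[ v < n ] H u v
    ≡⟨ sum-cong-≗ (λ u → sum-cong-≗ (split u)) ⟩
  ∑[ u < n ] ∑[ v < n ] (A u v + A v u)
    ≡⟨ sum-cong-≗ (λ u → ∑-distrib-+ (A u) (λ v → A v u)) ⟩
  ∑[ u < n ] (∑[ v < n ] A u v + ∑[ v < n ] A v u)
    ≡⟨ ∑-distrib-+ (λ u → ∑[ v < n ] A u v) (λ u → ∑[ v < n ] A v u) ⟩
  ΣA + ∑[ u < n ] ∑[ v < n ] A v u
    ≡⟨ cong (ΣA +_) (∑-comm (λ u v → A v u)) ⟩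
  ΣA + ΣA
    ≡⟨ cong (ΣA +_) (sym (+-identityʳ ΣA)) ⟩
  2 * ΣA ∎)
  where
  open ≡-Reasoning
  A : Fin n → Fin n → ℕ
  A = aboveDiagonal H
  ΣA : ℕ
  ΣA = ∑[ u < n ] ∑[ v < n ] A u v
  split : ∀ u v → H u v ≡ A u v + A v u
  split u v with <ᶠ-cmp u v
  ... | tri< u<v _ v≮u rewrite dec-true (u <ᶠ? v) u<v | dec-false (v <ᶠ? u) v≮u = sym (+-identityʳ _)
  ... | tri≈ u≮u refl _ rewrite dec-false (u <ᶠ? u) u≮u = H-diag u
  ... | tri> u≮v _ v<u rewrite dec-false (u <ᶠ? v) u≮v | dec-true (v <ᶠ? u) v<u = H-sym u v

∑-affine : ∀ {n} (f a g : Fin n → ℕ) b k → (∀ i → f i + a i ≡ b + k * g i) → ∑ f + ∑ a ≡ n * b + k * ∑ g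
∑-affine {n} f a g b k f+a≡b+kg = begin
  ∑ f + ∑ a                                  ≡⟨ sym (∑-distrib-+ f a) ⟩
  ∑[ i < n ] (f i + a i)                     ≡⟨ sum-cong-≗ f+a≡b+kg ⟩
  ∑[ i < n ] (b + k * g i)                   ≡⟨ ∑-distrib-+ (λ _ → b) (λ i → k * g i) ⟩
  ∑[ i < n ] b + ∑[ i < n ] (k * g i)        ≡⟨ cong₂ _+_ (∑-const n b) (sym (*-distribˡ-sum k g)) ⟩
  n * b + k * ∑ g                            ∎
  where open ≡-Reasoning

module WalkOps {n} (G : Graph n) where

  _∷ʳ_ : ∀ {u v w k} → Walk G u v k → Adj G v w → Walk G u w (suc k)
  here       ∷ʳ e = step e here
  step e′ p  ∷ʳ e = step e′ (p ∷ʳ e)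

  reverse : ∀ {u v k} → Walk G u v k → Walk G v u k
  reverse here       = here
  reverse (step e p) = reverse p ∷ʳ Graph.sym G e

  _++_ : ∀ {u v w k m} → Walk G u v k → Walk G v w m → Walk G u w (k + m)
  here     ++ q = q
  step e p ++ q = step e (p ++ q)

  first-edge : ∀ {u v k} → u ≢ v → Walk G u v k → ∃ λ x → Adj G u x
  first-edge u≢u here       = ⊥-elim (u≢u refl)
  first-edge _   (step e _) = _ , e

  short-walk : ∀ {u v k} → Walk G u v k → k ≤ 2 → u ≡ v ⊎ Adj G u v ⊎ ∃ λ w → Adj G u w × Adj G w v
  short-walk here                       _ = inj₁ refl
  short-walk (step e here)              _ = inj₂ (inj₁ e)
  short-walk (step e (step e′ here))    _ = inj₂ (inj₂ (_ , e , e′))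
  short-walk (step _ (step _ (step _ _))) (s≤s (s≤s ()))

module Distance {n} (G : Graph n) (d : Fin n → Fin n → ℕ) (isD : IsDistance G d) where
  open WalkOps G

  shortest : ∀ u v → Walk G u v (d u v)
  shortest u v = proj₁ (isD u v)

  minimal : ∀ {u v k} → Walk G u v k → d u v ≤ k
  minimal {u} {v} {k} = proj₂ (isD u v) k

  d-refl : ∀ u → d u u ≡ 0
  d-refl u = n≤0⇒n≡0 (minimal here)

  d-sym : ∀ u v → d u v ≡ d v u
  d-sym u v = ≤-antisym (minimal (reverse (shortest v u))) (minimal (reverse (shortest u v)))

  d-triangle : ∀ u v w → d u w ≤ d u v + d v w
  d-triangle u v w = minimal (shortest u v ++ shortest v w)

  d-step : ∀ {u v} r → Adj G u v → d u r ≤ suc (d v r)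
  d-step r e = minimal (step e (shortest _ r))

  d≤2-cases : ∀ {u v} → d u v ≤ 2 → u ≡ v ⊎ Adj G u v ⊎ ∃ λ w → Adj G u w × Adj G w v
  d≤2-cases = short-walk (shortest _ _)

  shortest-of-length : ∀ {u v k} → d u v ≡ k → Walk G u v k
  shortest-of-length {u} {v} d≡k = subst (Walk G u v) d≡k (shortest u v)

  d≡0⇒≡ : ∀ {u v} → d u v ≡ 0 → u ≡ v
  d≡0⇒≡ d≡0 with shortest-of-length d≡0
  ... | here = refl

  d≡1⇒adj : ∀ {u v} → d u v ≡ 1 → Adj G u v
  d≡1⇒adj d≡1 with shortest-of-length d≡1
  ... | step e here = e

  adj⇒d≡1 : ∀ {u v} → Adj G u v → d u v ≡ 1
  adj⇒d≡1 {u} e = ≤-antisym (minimal (step e here))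
                            (n≢0⇒n>0 λ d≡0 → Graph.irrefl G (subst (Adj G u) (sym (d≡0⇒≡ d≡0)) e))

  2≤d : ∀ {u v} → u ≢ v → ¬ Adj G u v → 2 ≤ d u v
  2≤d {u} {v} u≢v ¬uv with d u v in d≡k
  ... | zero        = ⊥-elim (u≢v (d≡0⇒≡ d≡k))
  ... | suc zero    = ⊥-elim (¬uv (d≡1⇒adj d≡k))
  ... | suc (suc _) = s≤s (s≤s z≤n)

  step-towards : ∀ {u v k} → d u v ≡ suc k → ∃ λ x → Adj G u x × d x v ≡ k
  step-towards {u} {v} {k} d≡1+k with shortest-of-length d≡1+k
  ... | step {w = x} e p =
    x , e , ≤-antisym (minimal p) (s≤s⁻¹ (≤-trans (≤-reflexive (sym d≡1+k)) (d-step v e)))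

  adj? : ∀ u v → Dec (Adj G u v)
  adj? u v with d u v ≟ 1
  ... | yes d≡1 = yes (d≡1⇒adj d≡1)
  ... | no  d≢1 = no (d≢1 ∘ adj⇒d≡1)

module _ {A : Set} where

  AllUpTo : ℕ → (A → Set) → (ℕ → A) → Set
  AllUpTo m Q f = ∀ {i} → i ≤ m → Q (f i)

  InjectiveUpTo : ℕ → (ℕ → A) → Set
  InjectiveUpTo m f = ∀ {i j} → i ≤ m → j ≤ m → f i ≡ f j → i ≡ j

  infixr 5 _◂_
  _◂_ : A → (ℕ → A) → ℕ → A
  (x ◂ f) zero    = x
  (x ◂ f) (suc i) = f i

  ◂-all : ∀ {m Q x f} → Q x → AllUpTo m Q f → AllUpTo (suc m) Q (x ◂ f)
  ◂-all Qx Qf {zero}  _  = Qx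
  ◂-all Qx Qf {suc i} i≤ = Qf (s≤s⁻¹ i≤)

  ◂-injective : ∀ {m x f} → InjectiveUpTo m f → AllUpTo m (_≢ x) f → InjectiveUpTo (suc m) (x ◂ f)
  ◂-injective inj new {zero}  {zero}  _  _  _  = refl
  ◂-injective inj new {zero}  {suc j} _  j≤ eq = ⊥-elim (new (s≤s⁻¹ j≤) (sym eq))
  ◂-injective inj new {suc i} {zero}  i≤ _  eq = ⊥-elim (new (s≤s⁻¹ i≤) eq)
  ◂-injective inj new {suc i} {suc j} i≤ j≤ eq = cong suc (inj (s≤s⁻¹ i≤) (s≤s⁻¹ j≤) eq)

  -- f 0, …, f m followed by y
  snocAt : ℕ → (ℕ → A) → A → ℕ → A
  snocAt zero    f y zero    = f zero
  snocAt zero    f y (suc _) = y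
  snocAt (suc m) f y zero    = f zero
  snocAt (suc m) f y (suc i) = snocAt m (λ i → f (suc i)) y i

  snocAt-≤ : ∀ {m f y i} → i ≤ m → snocAt m f y i ≡ f i
  snocAt-≤ {zero}  {i = zero}  _  = refl
  snocAt-≤ {suc m} {i = zero}  _  = refl
  snocAt-≤ {suc m} {i = suc i} i≤ = snocAt-≤ (s≤s⁻¹ i≤)

  snocAt-last : ∀ {m f y} → snocAt m f y (suc m) ≡ y
  snocAt-last {zero}  = refl
  snocAt-last {suc m} = snocAt-last {m = m}

  private
    ≤-suc-cases : ∀ {i m} → i ≤ suc m → i ≤ m ⊎ i ≡ suc m
    ≤-suc-cases i≤ with m≤n⇒m<n∨m≡n i≤
    ... | inj₁ i<1+m = inj₁ (s≤s⁻¹ i<1+m)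
    ... | inj₂ i≡1+m = inj₂ i≡1+m

  snocAt-all : ∀ {m Q f y} → AllUpTo m Q f → Q y → AllUpTo (suc m) Q (snocAt m f y)
  snocAt-all {m} {Q} Qf Qy i≤ with ≤-suc-cases i≤
  ... | inj₁ i≤m  = subst Q (sym (snocAt-≤ i≤m)) (Qf i≤m)
  ... | inj₂ refl = subst Q (sym (snocAt-last {m = m})) Qy

  snocAt-injective : ∀ {m f y} → InjectiveUpTo m f → AllUpTo m (_≢ y) f →
                     InjectiveUpTo (suc m) (snocAt m f y)
  snocAt-injective {m} inj new i≤ j≤ eq with ≤-suc-cases i≤ | ≤-suc-cases j≤
  ... | inj₁ i≤m  | inj₁ j≤m  = inj i≤m j≤m (trans (sym (snocAt-≤ i≤m)) (trans eq (snocAt-≤ j≤m)))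
  ... | inj₁ i≤m  | inj₂ refl = ⊥-elim (new i≤m (trans (sym (snocAt-≤ i≤m)) (trans eq (snocAt-last {m = m}))))
  ... | inj₂ refl | inj₁ j≤m  = ⊥-elim (new j≤m (trans (sym (snocAt-≤ j≤m)) (trans (sym eq) (snocAt-last {m = m}))))
  ... | inj₂ refl | inj₂ refl = refl

module Paths {n} (G : Graph n) where

  -- the path visits vertex 0, …, vertex m
  record Path (m : ℕ) : Set where
    field
      vertex   : ℕ → Fin n
      distinct : InjectiveUpTo m vertex
      linked   : ∀ {i} → i < m → Adj G (vertex i) (vertex (suc i))
  open Path public

  single : Fin n → Path 0
  single x = record { vertex = λ _ → x ; distinct = λ { z≤n z≤n _ → refl } ; linked = λ () }

  cons : ∀ {m x} (P : Path m) → Adj G x (vertex P 0) → AllUpTo m (_≢ x) (vertex P) → Path (suc m)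
  cons {x = x} P e new = record
    { vertex   = x ◂ vertex P
    ; distinct = ◂-injective (distinct P) new
    ; linked   = λ { {zero} _ → e ; {suc i} i<1+m → linked P (s≤s⁻¹ i<1+m) }
    }

  snoc : ∀ {m y} (P : Path m) → Adj G (vertex P m) y → AllUpTo m (_≢ y) (vertex P) → Path (suc m)
  snoc {m} {y} P e new = record
    { vertex   = snocAt m (vertex P) y
    ; distinct = snocAt-injective (distinct P) new
    ; linked   = linked′
    }
    where
    linked′ : ∀ {i} → i < suc m → Adj G (snocAt m (vertex P) y i) (snocAt m (vertex P) y (suc i))
    linked′ i<1+m with m≤n⇒m<n∨m≡n (s≤s⁻¹ i<1+m)
    ... | inj₁ i<m  = subst₂ (Adj G) (sym (snocAt-≤ (<⇒≤ i<m))) (sym (snocAt-≤ i<m)) (linked P i<m)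
    ... | inj₂ refl = subst₂ (Adj G) (sym (snocAt-≤ {m = m} {f = vertex P} ≤-refl))
                                     (sym (snocAt-last {m = m})) e

  closing-edge-cycle : ∀ {k} (P : Path (2 + k)) → Adj G (vertex P (2 + k)) (vertex P 0) → HasCycle G
  closing-edge-cycle {k} P e = k , (λ i → vertex P (toℕ i)) , injective , cycle-linked , closing
    where
    injective : ∀ {i j : Fin (3 + k)} → vertex P (toℕ i) ≡ vertex P (toℕ j) → i ≡ j
    injective {i} {j} eq = toℕ-injective (distinct P (s≤s⁻¹ (toℕ<n i)) (s≤s⁻¹ (toℕ<n j)) eq)
    cycle-linked : ∀ (i : Fin (2 + k)) → Adj G (vertex P (toℕ (inject₁ i))) (vertex P (suc (toℕ i)))
    cycle-linked i rewrite toℕ-inject₁ i = linked P (toℕ<n i)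
    closing : Adj G (vertex P (toℕ (fromℕ (2 + k)))) (vertex P 0)
    closing rewrite toℕ-fromℕ (2 + k) = e

  distinct-≢ : ∀ {m} (P : Path m) {i j} → i ≤ m → j ≤ m → i ≢ j → vertex P i ≢ vertex P j
  distinct-≢ P i≤ j≤ i≢j = i≢j ∘ distinct P i≤ j≤

module RootedTree {n} (T : Graph n) (acyclic : Acyclic T)
                  (D : Fin n → Fin n → ℕ) (isD : IsDistance T D) (r : Fin n) where
  open Distance T D isD
  open Paths T

  depth : Fin n → ℕ
  depth x = D x r

  record LevelPath (j : ℕ) : Set where
    field
      len   : ℕ
      path  : Path (suc len)
      start : depth (vertex path 0) ≡ j
      end   : depth (vertex path (suc len)) ≡ j
      below : AllUpTo (suc len) (λ x → j ≤ depth x) (vertex path)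

  private
    fresh : ∀ {j} (L : LevelPath (suc j)) {x} → depth x ≡ j →
            AllUpTo (suc (LevelPath.len L)) (_≢ x) (vertex (LevelPath.path L))
    fresh {j} L depth-x i≤ refl = 1+n≰n (subst (suc j ≤_) depth-x (LevelPath.below L i≤))

  no-level-path : ∀ j → ¬ LevelPath j
  no-level-path zero L = 0≢1+n (distinct path z≤n ≤-refl (trans (d≡0⇒≡ start) (sym (d≡0⇒≡ end))))
    where open LevelPath L
  no-level-path (suc j) L with step-towards (LevelPath.start L) | step-towards (LevelPath.end L)
  ... | a , first-a , depth-a | b , last-b , depth-b with a ≟ᶠ b
  ...   | yes refl = acyclic (closing-edge-cycle (cons path (Graph.sym T first-a) (fresh L depth-a)) last-b)
    where open LevelPath L
  ...   | no a≢b = no-level-path j (record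
    { len   = suc (suc len)
    ; path  = cons (snoc path last-b (fresh L depth-b)) (Graph.sym T first-a)
                   (snocAt-all {Q = _≢ a} (fresh L depth-a) (a≢b ∘ sym))
    ; start = depth-a
    ; end   = trans (cong depth (snocAt-last {m = suc len} {f = vertex path})) depth-b
    ; below = ◂-all {Q = λ x → j ≤ depth x} (≤-reflexive (sym depth-a))
                    (snocAt-all {Q = λ x → j ≤ depth x} (λ i≤ → ≤-trans (n≤1+n j) (below i≤))
                                (≤-reflexive (sym depth-b)))
    })
    where open LevelPath L

  adjacent-depth : ∀ {u v} → Adj T u v → depth u ≡ suc (depth v) ⊎ depth v ≡ suc (depth u)
  adjacent-depth {u} {v} e with <-cmp (depth u) (depth v)
  ... | tri< u<v _ _ = inj₂ (≤-antisym (d-step r (Graph.sym T e)) u<v)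
  ... | tri> _ _ v<u = inj₁ (≤-antisym (d-step r e) v<u)
  ... | tri≈ _ u≈v _ = ⊥-elim (no-level-path (depth u) (record
    { len   = 0
    ; path  = cons (single v) e (λ _ v≡u → Graph.irrefl T (subst (Adj T u) v≡u e))
    ; start = refl
    ; end   = sym u≈v
    ; below = ◂-all {Q = λ x → depth u ≤ depth x} ≤-refl (λ _ → ≤-reflexive u≈v)
    }))

  parent-unique : ∀ {w u₁ u₂} → Adj T w u₁ → Adj T w u₂ →
                  depth w ≡ suc (depth u₁) → depth w ≡ suc (depth u₂) → u₁ ≡ u₂
  parent-unique {w} {u₁} {u₂} wu₁ wu₂ w₁ w₂ with u₁ ≟ᶠ u₂
  ... | yes u₁≡u₂ = u₁≡u₂
  ... | no u₁≢u₂ = ⊥-elim (no-level-path (depth u₁) (record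
    { len   = 1
    ; path  = cons (cons (single u₂) wu₂ (λ _ → above w₂ ∘ sym)) (Graph.sym T wu₁)
                   (◂-all {Q = _≢ u₁} (above w₁) (λ _ → u₁≢u₂ ∘ sym))
    ; start = refl
    ; end   = suc-injective (trans (sym w₂) w₁)
    ; below = ◂-all {Q = λ x → depth u₁ ≤ depth x} ≤-refl
                (◂-all {Q = λ x → depth u₁ ≤ depth x} (≤-trans (n≤1+n _) (≤-reflexive (sym w₁)))
                       (λ _ → ≤-reflexive (suc-injective (trans (sym w₁) w₂))))
    }))
    where
    above : ∀ {u} → depth w ≡ suc (depth u) → w ≢ u
    above w≡1+u refl = 1+n≢n (sym w≡1+u)

  moving-away : ∀ {u v w} → Adj T u v → Adj T v w → w ≢ u →
                depth v ≡ suc (depth u) → depth w ≡ suc (depth v)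
  moving-away uv vw w≢u v≡1+u with adjacent-depth vw
  ... | inj₂ w≡1+v = w≡1+v
  ... | inj₁ v≡1+w = ⊥-elim (w≢u (parent-unique vw (Graph.sym T uv) v≡1+w v≡1+u))

  parent-exists : ∀ {x} → x ≢ r → ∃ λ p → Adj T x p × depth x ≡ suc (depth p)
  parent-exists {x} x≢r with depth x in x≡k
  ... | zero  = ⊥-elim (x≢r (d≡0⇒≡ x≡k))
  ... | suc k with step-towards x≡k
  ...   | p , xp , p≡k = p , xp , cong suc (sym p≡k)

  path-towards-root : ∀ m {x} → m ≤ depth x →
    Σ (Path m) λ P → vertex P 0 ≡ x × AllUpTo m (λ y → depth y ≤ depth x) (vertex P)
  path-towards-root zero {x} _ = single x , refl , λ _ → ≤-refl
  path-towards-root (suc m) {x} m<x with parent-exists {x} (λ { refl → m<n⇒n≢0 m<x (d-refl _) })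
  ... | p , xp , x≡1+p with path-towards-root m {p} (s≤s⁻¹ (subst (suc m ≤_) x≡1+p m<x))
  ...   | P , P₀≡p , P≤p = cons P (subst (Adj T x) (sym P₀≡p) xp) x-fresh
                          , refl
                          , ◂-all {Q = λ y → depth y ≤ depth x} ≤-refl (λ i≤ → ≤-trans (P≤p i≤) p≤x)
    where
    p≤x : depth p ≤ depth x
    p≤x = ≤-trans (n≤1+n _) (≤-reflexive (sym x≡1+p))
    x-fresh : AllUpTo m (_≢ x) (vertex P)
    x-fresh i≤ refl = 1+n≰n (subst (_≤ depth p) x≡1+p (P≤p i≤))

  private
    two-steps-down : ∀ {a b c} → a ≡ suc b → b ≡ suc c → 2 ≤ c → 4 ≤ a
    two-steps-down refl refl 2≤c = s≤s (s≤s 2≤c)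

  far-end : (P : Path 3) → 2 ≤ depth (vertex P 1) → 2 ≤ depth (vertex P 2) → ∃ λ x → 4 ≤ depth x
  far-end P 2≤x₁ 2≤x₂ with adjacent-depth (linked P {1} (s≤s (s≤s z≤n)))
  ... | inj₁ x₁≡1+x₂ = vertex P 0 , two-steps-down x₀≡1+x₁ x₁≡1+x₂ 2≤x₂
    where
    x₀≡1+x₁ : depth (vertex P 0) ≡ suc (depth (vertex P 1))
    x₀≡1+x₁ = moving-away (Graph.sym T (linked P {1} (s≤s (s≤s z≤n)))) (Graph.sym T (linked P {0} (s≤s z≤n)))
                          (distinct-≢ P z≤n (s≤s (s≤s z≤n)) λ ()) x₁≡1+x₂
  ... | inj₂ x₂≡1+x₁ = vertex P 3 , two-steps-down x₃≡1+x₂ x₂≡1+x₁ 2≤x₁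
    where
    x₃≡1+x₂ : depth (vertex P 3) ≡ suc (depth (vertex P 2))
    x₃≡1+x₂ = moving-away (linked P {1} (s≤s (s≤s z≤n))) (linked P {2} ≤-refl)
                          (distinct-≢ P ≤-refl (s≤s z≤n) λ ()) x₂≡1+x₁

  long-path : ∀ {u v} → Adj T u v → 2 ≤ depth u → 2 ≤ depth v → Path 3
  long-path uv 2≤u 2≤v with adjacent-depth uv
  ... | inj₁ u≡1+v = proj₁ (path-towards-root 3 (subst (3 ≤_) (sym u≡1+v) (s≤s 2≤v)))
  ... | inj₂ v≡1+u = proj₁ (path-towards-root 3 (subst (3 ≤_) (sym v≡1+u) (s≤s 2≤u)))

  _isParentOf_ : Fin n → Fin n → Set
  p isParentOf x = Adj T x p × depth x ≡ suc (depth p)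

  _isParentOf?_ : ∀ p x → Dec (p isParentOf x)
  p isParentOf? x = adj? x p ×-dec (depth x ≟ suc (depth p))

  adjacency-as-parenthood : ∀ u v → 𝟙 (adj? u v) ≡ 𝟙 (u isParentOf? v) + 𝟙 (v isParentOf? u)
  adjacency-as-parenthood u v = by-cases (adj? u v)
    where
    not-both : depth u ≡ suc (depth v) → depth v ≡ suc (depth u) → ⊥
    not-both u≡1+v v≡1+u = <-asym (≤-reflexive (sym u≡1+v)) (≤-reflexive (sym v≡1+u))
    by-cases : Dec (Adj T u v) → 𝟙 (adj? u v) ≡ 𝟙 (u isParentOf? v) + 𝟙 (v isParentOf? u)
    by-cases (no ¬uv) = trans (𝟙-no (adj? u v) ¬uv) (sym (cong₂ _+_
      (𝟙-no (u isParentOf? v) (¬uv ∘ Graph.sym T ∘ proj₁))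
      (𝟙-no (v isParentOf? u) (¬uv ∘ proj₁))))
    by-cases (yes uv) with adjacent-depth uv
    ... | inj₁ u≡1+v = trans (𝟙-yes (adj? u v) uv) (sym (cong₂ _+_
      (𝟙-no (u isParentOf? v) (not-both u≡1+v ∘ proj₂))
      (𝟙-yes (v isParentOf? u) (uv , u≡1+v))))
    ... | inj₂ v≡1+u = trans (𝟙-yes (adj? u v) uv) (sym (cong₂ _+_
      (𝟙-yes (u isParentOf? v) (Graph.sym T uv , v≡1+u))
      (𝟙-no (v isParentOf? u) (flip not-both v≡1+u ∘ proj₂))))

  parent-count : ∀ v → ∑[ u < n ] 𝟙 (u isParentOf? v) + 𝟙 (v ≟ᶠ r) ≡ 1
  parent-count v with v ≟ᶠ r
  ... | yes refl = cong (_+ 1) (∑-zero _ λ u →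
    𝟙-no (u isParentOf? r) λ (_ , r≡1+u) → 0≢1+n (trans (sym (d-refl r)) r≡1+u))
  ... | no v≢r with parent-exists v≢r
  ...   | p , vp , v≡1+p =
    trans (+-identityʳ _) (trans (∑-single _ p only-p) (𝟙-yes (p isParentOf? v) (vp , v≡1+p)))
    where
    only-p : ∀ u → u ≢ p → 𝟙 (u isParentOf? v) ≡ 0
    only-p u u≢p = 𝟙-no (u isParentOf? v) λ (vu , v≡1+u) → u≢p (parent-unique vu vp v≡1+u v≡1+p)

  private
    twice-suc : ∀ x → x + x + 2 ≡ 2 * (x + 1)
    twice-suc = solve-∀

  -- Every vertex but the root has exactly one parent, and every edge joins a vertex to its parent.
  ∑∑-adjacency : ∑[ u < n ] ∑[ v < n ] 𝟙 (adj? u v) + 2 ≡ 2 * n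
  ∑∑-adjacency = begin
    ∑[ u < n ] ∑[ v < n ] 𝟙 (adj? u v) + 2
      ≡⟨ cong (_+ 2) (trans (sum-cong-≗ λ u → trans (sum-cong-≗ (adjacency-as-parenthood u))
                                                    (∑-distrib-+ (π u) (λ v → π v u)))
                            (∑-distrib-+ (λ u → ∑[ v < n ] π u v) (λ u → ∑[ v < n ] π v u))) ⟩
    ∑[ u < n ] ∑[ v < n ] π u v + X + 2
      ≡⟨ cong (λ s → s + X + 2) (∑-comm π) ⟩
    X + X + 2
      ≡⟨ twice-suc X ⟩
    2 * (X + 1)
      ≡⟨ cong (2 *_) X+1≡n ⟩
    2 * n ∎
    where
    open ≡-Reasoning
    π : Fin n → Fin n → ℕ
    π u v = 𝟙 (u isParentOf? v)
    X : ℕ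
    X = ∑[ v < n ] ∑[ u < n ] π u v
    X+1≡n : X + 1 ≡ n
    X+1≡n = begin
      X + 1
        ≡⟨ cong (X +_) (sym (trans (∑-single _ r (λ v → 𝟙-no (v ≟ᶠ r))) (𝟙-yes (r ≟ᶠ r) refl))) ⟩
      X + ∑[ v < n ] 𝟙 (v ≟ᶠ r)
        ≡⟨ sym (∑-distrib-+ (λ v → ∑[ u < n ] π u v) (λ v → 𝟙 (v ≟ᶠ r))) ⟩
      ∑[ v < n ] (∑[ u < n ] π u v + 𝟙 (v ≟ᶠ r))
        ≡⟨ sum-cong-≗ parent-count ⟩
      ∑[ v < n ] 1
        ≡⟨ trans (∑-const n 1) (*-identityʳ n) ⟩
      n ∎

peripheralWeight : ∀ {n} → (Fin n → Fin n → ℕ) → Fin n → Fin n → ℕ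
peripheralWeight d u v = if isPeripheral d u ∧ isPeripheral d v then d u v + d u v * d u v else 0

2*PWWsum : ∀ {n} (d : Fin n → Fin n → ℕ) → (∀ u v → d u v ≡ d v u) → (∀ u → d u u ≡ 0) →
           2 * PWWsum d ≡ ∑[ u < n ] ∑[ v < n ] peripheralWeight d u v
2*PWWsum {n} d d-sym d-refl = begin
  2 * PWWsum d                                      ≡⟨ cong (2 *_) PWWsum≡ ⟩
  2 * (∑[ u < n ] ∑[ v < n ] aboveDiagonal W u v)  ≡⟨ ∑∑-aboveDiagonal W W-sym W-diag ⟩
  ∑[ u < n ] ∑[ v < n ] W u v                      ∎
  where
  open ≡-Reasoning
  W : Fin n → Fin n → ℕ
  W = peripheralWeight d
  above : ∀ u v → (if does (u <ᶠ? v) ∧ isPeripheral d u ∧ isPeripheral d v then d u v + d u v * d u v else 0)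
                ≡ aboveDiagonal W u v
  above u v with does (u <ᶠ? v)
  ... | true  = refl
  ... | false = refl
  PWWsum≡ : PWWsum d ≡ ∑[ u < n ] ∑[ v < n ] aboveDiagonal W u v
  PWWsum≡ = trans (sumOver≡∑ {n} _) (sum-cong-≗ λ u → trans (sumOver≡∑ {n} _) (sum-cong-≗ (above u)))
  W-sym : ∀ u v → W u v ≡ W v u
  W-sym u v rewrite d-sym u v | ∧-comm (isPeripheral d u) (isPeripheral d v) = refl
  W-diag : ∀ u → W u u ≡ 0
  W-diag u rewrite d-refl u with isPeripheral d u ∧ isPeripheral d u
  ... | true  = refl
  ... | false = refl

other-vertex : ∀ {n} → 2 ≤ n → (v : Fin n) → ∃ λ t → v ≢ t
other-vertex (s≤s (s≤s _)) zero    = suc zero , λ ()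
other-vertex (s≤s (s≤s _)) (suc _) = zero , λ ()

pww-arithmetic : ∀ n P E → 2 * P + n * 2 ≡ n * (n * 2) + 4 * E → E + 2 ≡ 2 * n → P + 4 ≡ n * n + 3 * n
pww-arithmetic n P E h₁ h₂ = *-cancelˡ-≡ (P + 4) (n * n + 3 * n) 2 (+-cancelʳ-≡ (n * 2) _ _ (begin
  2 * (P + 4) + n * 2              ≡⟨ solve (n ∷ P ∷ []) ⟩
  2 * P + n * 2 + 8                ≡⟨ cong (_+ 8) h₁ ⟩
  n * (n * 2) + 4 * E + 8          ≡⟨ solve (n ∷ E ∷ []) ⟩
  n * (n * 2) + 4 * (E + 2)        ≡⟨ cong (λ t → n * (n * 2) + 4 * t) h₂ ⟩
  n * (n * 2) + 4 * (2 * n)        ≡⟨ solve (n ∷ []) ⟩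
  2 * (n * n + 3 * n) + n * 2      ∎))
  where open ≡-Reasoning

module TreeComplement {n} (T : Graph n) (acyclic : Acyclic T) (d D : Fin n → Fin n → ℕ)
                      (isd : IsDistance (complement T) d) (isD : IsDistance T D) where

  Tᶜ : Graph n
  Tᶜ = complement T

  open Distance T D isD
  module C = Distance Tᶜ d isd
  open WalkOps using (first-edge)
  open Paths T using (Path; vertex; linked)
  module Rooted = RootedTree T acyclic D isD

  infix 4 _∈N[_]
  _∈N[_] : Fin n → Fin n → Set
  w ∈N[ a ] = w ≡ a ⊎ Adj T w a

  adjᶜ⇒∉N : ∀ {w a} → Adj Tᶜ w a → ¬ w ∈N[ a ]
  adjᶜ⇒∉N (w≢a , ¬wa) = [ w≢a , ¬wa ]

  2≤D : ∀ {w v} → Adj Tᶜ w v → 2 ≤ D v w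
  2≤D (w≢v , ¬wv) = 2≤d (w≢v ∘ sym) (¬wv ∘ Graph.sym T)

  Dominating : Fin n → Fin n → Set
  Dominating a b = Adj T a b × (∀ w → w ∈N[ a ] ⊎ w ∈N[ b ])

  near? : ∀ w a → Dec (w ∈N[ a ])
  near? w a = (w ≟ᶠ a) ⊎-dec adj? w a

  dominating? : Dec (∃₂ Dominating)
  dominating? = any? λ a → any? λ b → adj? a b ×-dec all? λ w → near? w a ⊎-dec near? w b

  W : Fin n → Fin n → ℕ
  W = peripheralWeight d

  2*PWWsum≡∑∑W : 2 * PWWsum d ≡ ∑[ u < n ] ∑[ v < n ] W u v
  2*PWWsum≡∑∑W = 2*PWWsum d C.d-sym C.d-refl

  module EndOf {a b} (ab : Adj T a b) (cover : ∀ w → w ∈N[ a ] ⊎ w ∈N[ b ]) where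

    a≢b : a ≢ b
    a≢b refl = Graph.irrefl T ab

    pendant : ∀ {u v} → u ≢ b → Adj T u a → Adj T u v → v ≡ a
    pendant {u} {v} u≢b ua uv with v ≟ᶠ a
    ... | yes v≡a = v≡a
    ... | no v≢a = ⊥-elim (not-near (cover v))
      where
      open Rooted a
      u≡1 : depth u ≡ 1
      u≡1 = adj⇒d≡1 ua
      b≡1 : depth b ≡ 1
      b≡1 = adj⇒d≡1 (Graph.sym T ab)
      v≡1+u : depth v ≡ suc (depth u)
      v≡1+u = moving-away (Graph.sym T ua) uv v≢a (trans u≡1 (cong suc (sym (d-refl a))))
      v≢1 : depth v ≢ 1
      v≢1 v≡1 = 1+n≢n (trans (sym v≡1+u) (trans v≡1 (sym u≡1)))
      not-near : ¬ (v ∈N[ a ] ⊎ v ∈N[ b ])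
      not-near (inj₁ (inj₁ v≡a)) = v≢a v≡a
      not-near (inj₁ (inj₂ va))  = v≢1 (adj⇒d≡1 va)
      not-near (inj₂ (inj₁ refl)) = v≢1 b≡1
      not-near (inj₂ (inj₂ vb))  = u≢b (parent-unique (Graph.sym T uv) vb v≡1+u
                                                      (trans v≡1+u (cong suc (trans u≡1 (sym b≡1)))))

    x : Fin n
    x = proj₁ (first-edge Tᶜ a≢b (C.shortest a b))

    ax : Adj Tᶜ a x
    ax = proj₂ (first-edge Tᶜ a≢b (C.shortest a b))

    xb : Adj T x b
    xb with cover x
    ... | inj₁ x∈N[a]      = ⊥-elim (adjᶜ⇒∉N (Graph.sym Tᶜ ax) x∈N[a])
    ... | inj₂ (inj₁ x≡b)  = ⊥-elim (proj₂ ax (subst (Adj T a) (sym x≡b) ab))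
    ... | inj₂ (inj₂ xb)   = xb

    via-x : ∀ {u} → u ≢ b → Adj T u a → d u a ≤ 2
    via-x {u} u≢b ua = C.minimal (step ux (step (Graph.sym Tᶜ ax) here))
      where
      ux : Adj Tᶜ u x
      ux = (λ { refl → proj₂ ax (Graph.sym T ua) }) , (λ u~x → proj₁ ax (sym (pendant u≢b ua u~x)))

  module DominatingEdge {a b} (ab : Adj T a b) (cover : ∀ w → w ∈N[ a ] ⊎ w ∈N[ b ]) where
    open EndOf ab cover
    open EndOf (Graph.sym T ab) (Sum.swap ∘ cover)
      using () renaming (x to y; ax to by; xb to ya; via-x to via-y; pendant to pendantᵇ)

    D-yx : D y x ≡ 3
    D-yx = trans y≡1+a (cong suc (trans a≡1+b (cong suc (trans b≡1+x (cong suc (d-refl x))))))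
      where
      open Rooted x
      b≡1+x : depth b ≡ suc (depth x)
      b≡1+x = trans (adj⇒d≡1 (Graph.sym T xb)) (cong suc (sym (d-refl x)))
      a≡1+b : depth a ≡ suc (depth b)
      a≡1+b = moving-away xb (Graph.sym T ab) (proj₁ ax) b≡1+x
      y≡1+a : depth y ≡ suc (depth a)
      y≡1+a = moving-away (Graph.sym T ab) (Graph.sym T ya) (proj₁ by ∘ sym) a≡1+b

    d-ab : d a b ≡ 3
    d-ab = ≤-antisym (C.minimal (step ax (step xy (step (Graph.sym Tᶜ by) here)))) (≰⇒> not-close)
      where
      xy : Adj Tᶜ x y
      xy = (λ x≡y → 1+n≢0 (trans (sym D-yx) (trans (cong (λ z → D z x) (sym x≡y)) (d-refl x))))
         , (λ x~y → 1+n≢0 (suc-injective (trans (sym D-yx) (adj⇒d≡1 (Graph.sym T x~y)))))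
      not-close : ¬ (d a b ≤ 2)
      not-close d≤2 with C.d≤2-cases d≤2
      ... | inj₁ a≡b                   = a≢b a≡b
      ... | inj₂ (inj₁ ab′)            = proj₂ ab′ ab
      ... | inj₂ (inj₂ (w , aw , wb)) = [ adjᶜ⇒∉N (Graph.sym Tᶜ aw) , adjᶜ⇒∉N wb ] (cover w)

    IsEnd : Fin n → Set
    IsEnd u = u ≡ a ⊎ u ≡ b

    others-near : ∀ {u} → ¬ IsEnd u → ∀ v → d u v ≤ 2
    others-near {u} ¬end v with u ≟ᶠ v | adj? u v
    ... | yes refl | _      = ≤-trans (≤-reflexive (C.d-refl u)) z≤n
    ... | no u≢v   | no ¬uv = ≤-trans (≤-reflexive (C.adj⇒d≡1 (u≢v , ¬uv))) (s≤s z≤n)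
    ... | no _     | yes uv with cover u
    ...   | inj₁ (inj₁ u≡a) = ⊥-elim (¬end (inj₁ u≡a))
    ...   | inj₁ (inj₂ ua)  rewrite pendant (¬end ∘ inj₂) ua uv = via-x (¬end ∘ inj₂) ua
    ...   | inj₂ (inj₁ u≡b) = ⊥-elim (¬end (inj₂ u≡b))
    ...   | inj₂ (inj₂ ub)  rewrite pendantᵇ (¬end ∘ inj₁) ub uv = via-y (¬end ∘ inj₁) ub

    d≤3 : ∀ u v → d u v ≤ 3
    d≤3 u v with (u ≟ᶠ a) ⊎-dec (u ≟ᶠ b) | (v ≟ᶠ a) ⊎-dec (v ≟ᶠ b)
    ... | no ¬end | _       = ≤-trans (others-near ¬end v) (n≤1+n 2)
    ... | _       | no ¬end = ≤-trans (≤-reflexive (C.d-sym u v)) (≤-trans (others-near ¬end u) (n≤1+n 2))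
    ... | yes (inj₁ refl) | yes (inj₁ refl) = ≤-trans (≤-reflexive (C.d-refl a)) z≤n
    ... | yes (inj₁ refl) | yes (inj₂ refl) = ≤-reflexive d-ab
    ... | yes (inj₂ refl) | yes (inj₁ refl) = ≤-reflexive (trans (C.d-sym b a) d-ab)
    ... | yes (inj₂ refl) | yes (inj₂ refl) = ≤-trans (≤-reflexive (C.d-refl b)) z≤n

    diam-d : diam d ≡ 3
    diam-d = diam-attained d a b d-ab d≤3

    end-peripheral : ∀ {v} → IsEnd v → isPeripheral d v ≡ true
    end-peripheral {v} end = dec-true (ecc d v ≟ diam d) (trans (ecc-end end) (sym diam-d))
      where
      ecc-end : IsEnd v → ecc d v ≡ 3
      ecc-end (inj₁ refl) = maxOver-attained (λ u → d u a) b (trans (C.d-sym b a) d-ab) (λ u → d≤3 u a)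
      ecc-end (inj₂ refl) = maxOver-attained (λ u → d u b) a d-ab (λ u → d≤3 u b)

    other-not-peripheral : ∀ {v} → ¬ IsEnd v → isPeripheral d v ≡ false
    other-not-peripheral {v} ¬end = dec-false (ecc d v ≟ diam d) λ ecc≡diam →
      1+n≰n (subst (_≤ 2) (trans ecc≡diam diam-d)
                   (maxOver-≤ (λ u → d u v) λ u → subst (_≤ 2) (C.d-sym v u) (others-near ¬end u)))

    ∑∑W : ∑[ u < n ] ∑[ v < n ] W u v ≡ 24
    ∑∑W = begin
      ∑[ u < n ] ∑[ v < n ] W u v
        ≡⟨ ∑-pair _ a≢b (λ u u≢a u≢b → ∑-zero _ (W-row [ u≢a , u≢b ])) ⟩
      ∑[ v < n ] W a v + ∑[ v < n ] W b v
        ≡⟨ cong₂ _+_ (∑-pair _ a≢b (λ v v≢a v≢b → W-column [ v≢a , v≢b ] a))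
                     (∑-pair _ a≢b (λ v v≢a v≢b → W-column [ v≢a , v≢b ] b)) ⟩
      (W a a + W a b) + (W b a + W b b)
        ≡⟨ cong₂ _+_ (cong₂ _+_ (ends (inj₁ refl) (inj₁ refl) (C.d-refl a))
                                (ends (inj₁ refl) (inj₂ refl) d-ab))
                     (cong₂ _+_ (ends (inj₂ refl) (inj₁ refl) (trans (C.d-sym b a) d-ab))
                                (ends (inj₂ refl) (inj₂ refl) (C.d-refl b))) ⟩
      24 ∎
      where
      open ≡-Reasoning
      ends : ∀ {u v} → IsEnd u → IsEnd v → ∀ {k} → d u v ≡ k → W u v ≡ k + k * k
      ends eu ev refl rewrite end-peripheral eu | end-peripheral ev = refl
      W-row : ∀ {u} → ¬ IsEnd u → ∀ v → W u v ≡ 0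
      W-row ¬end v rewrite other-not-peripheral ¬end = refl
      W-column : ∀ {v} → ¬ IsEnd v → ∀ u → W u v ≡ 0
      W-column {v} ¬end u rewrite other-not-peripheral ¬end | ∧-zeroʳ (isPeripheral d u) = refl

    PWW≡6 : PWW d ≡ 6
    PWW≡6 = cong (_/ 2) (*-cancelˡ-≡ (PWWsum d) 12 2 (trans 2*PWWsum≡∑∑W ∑∑W))

    diam-D : diam D ≡ 3
    diam-D = diam-attained D y x D-yx D≤3
      where
      hub : ∀ u → ∃ λ h → IsEnd h × D u h ≤ 1
      hub u with cover u
      ... | inj₁ (inj₁ refl) = a , inj₁ refl , ≤-trans (≤-reflexive (d-refl a)) z≤n
      ... | inj₁ (inj₂ ua)   = a , inj₁ refl , ≤-reflexive (adj⇒d≡1 ua)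
      ... | inj₂ (inj₁ refl) = b , inj₂ refl , ≤-trans (≤-reflexive (d-refl b)) z≤n
      ... | inj₂ (inj₂ ub)   = b , inj₂ refl , ≤-reflexive (adj⇒d≡1 ub)
      ends-close : ∀ {h h′} → IsEnd h → IsEnd h′ → D h h′ ≤ 1
      ends-close (inj₁ refl) (inj₁ refl) = ≤-trans (≤-reflexive (d-refl a)) z≤n
      ends-close (inj₁ refl) (inj₂ refl) = ≤-reflexive (adj⇒d≡1 ab)
      ends-close (inj₂ refl) (inj₁ refl) = ≤-reflexive (adj⇒d≡1 (Graph.sym T ab))
      ends-close (inj₂ refl) (inj₂ refl) = ≤-trans (≤-reflexive (d-refl b)) z≤n
      D≤3 : ∀ u v → D u v ≤ 3
      D≤3 u v with hub u | hub v
      ... | h , eh , uh | h′ , eh′ , vh′ = begin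
        D u v                 ≤⟨ d-triangle u h v ⟩
        D u h + D h v         ≤⟨ +-monoʳ-≤ (D u h) (d-triangle h h′ v) ⟩
        D u h + (D h h′ + D h′ v) ≤⟨ +-mono-≤ uh (+-mono-≤ (ends-close eh eh′)
                                                            (subst (_≤ 1) (d-sym v h′) vh′)) ⟩
        3                     ∎
        where open ≤-Reasoning

  module NoDominatingEdge (2≤n : 2 ≤ n)
                          (far : ∀ {u v} → Adj T u v → ∃ λ w → Adj Tᶜ w u × Adj Tᶜ w v) where

    neighbour : ∀ v → ∃ (Adj T v)
    neighbour v with other-vertex 2≤n v
    ... | t , v≢t = first-edge T v≢t (shortest v t)

    d-edge : ∀ {u v} → Adj T u v → d u v ≡ 2
    d-edge {u} uv with far uv
    ... | w , wu , wv = ≤-antisym (C.minimal (step (Graph.sym Tᶜ wu) (step wv here)))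
                                  (C.2≤d (λ { refl → Graph.irrefl T uv }) (λ uv′ → proj₂ uv′ uv))

    d≤2 : ∀ u v → d u v ≤ 2
    d≤2 u v with u ≟ᶠ v | adj? u v
    ... | yes refl | _      = ≤-trans (≤-reflexive (C.d-refl u)) z≤n
    ... | no u≢v   | no ¬uv = ≤-trans (≤-reflexive (C.adj⇒d≡1 (u≢v , ¬uv))) (s≤s z≤n)
    ... | no _     | yes uv = ≤-reflexive (d-edge uv)

    ecc-d : ∀ v → ecc d v ≡ 2
    ecc-d v = maxOver-attained (λ u → d u v) (proj₁ (neighbour v)) (d-edge (Graph.sym T (proj₂ (neighbour v))))
                               (λ u → d≤2 u v)

    all-peripheral : ∀ v → isPeripheral d v ≡ true
    all-peripheral v = dec-true (ecc d v ≟ diam d) (trans (ecc-d v) (sym diam-d))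
      where
      v₀ : Fin n
      v₀ = fromℕ< 2≤n
      diam-d : diam d ≡ 2
      diam-d = diam-attained d (proj₁ (neighbour v₀)) v₀ (d-edge (Graph.sym T (proj₂ (neighbour v₀)))) d≤2

    W-decomposition : ∀ u v → W u v + 2 * 𝟙 (u ≟ᶠ v) ≡ 2 + 4 * 𝟙 (adj? u v)
    W-decomposition u v rewrite all-peripheral u | all-peripheral v with u ≟ᶠ v | adj? u v
    ... | yes refl | no _   rewrite C.d-refl u = refl
    ... | yes refl | yes uu = ⊥-elim (Graph.irrefl T uu)
    ... | no _     | yes uv rewrite d-edge uv = refl
    ... | no u≢v   | no ¬uv rewrite C.adj⇒d≡1 (u≢v , ¬uv) = refl

    ∑∑W : ∑[ u < n ] ∑[ v < n ] W u v + n * 2 ≡ n * (n * 2) + 4 * ∑[ u < n ] ∑[ v < n ] 𝟙 (adj? u v)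
    ∑∑W = trans (cong (∑[ u < n ] ∑[ v < n ] W u v +_) (sym (∑-const n 2)))
                (∑-affine _ (λ _ → 2) _ (n * 2) 4 row)
      where
      row : ∀ u → ∑[ v < n ] W u v + 2 ≡ n * 2 + 4 * ∑[ v < n ] 𝟙 (adj? u v)
      row u = trans (cong (∑[ v < n ] W u v +_) (sym ∑-diagonal))
                    (∑-affine (W u) (λ v → 2 * 𝟙 (u ≟ᶠ v)) (λ v → 𝟙 (adj? u v)) 2 4 (W-decomposition u))
        where
        ∑-diagonal : ∑[ v < n ] (2 * 𝟙 (u ≟ᶠ v)) ≡ 2
        ∑-diagonal = trans (sym (*-distribˡ-sum 2 (λ v → 𝟙 (u ≟ᶠ v))))
                           (cong (2 *_) (trans (∑-single _ u λ v v≢u → 𝟙-no (u ≟ᶠ v) (v≢u ∘ sym))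
                                               (𝟙-yes (u ≟ᶠ u) refl)))

    PWW≡formula : PWW d ≡ (n * n + 3 * n ∸ 4) / 2
    PWW≡formula = cong (_/ 2) (sym (trans (cong (_∸ 4) (sym PWWsum+4)) (m+n∸n≡m (PWWsum d) 4)))
      where
      PWWsum+4 : PWWsum d + 4 ≡ n * n + 3 * n
      PWWsum+4 = pww-arithmetic n (PWWsum d) _ (trans (cong (_+ n * 2) 2*PWWsum≡∑∑W) ∑∑W)
                                                (Rooted.∑∑-adjacency (fromℕ< 2≤n))

    3<diam-D : 3 < diam D
    3<diam-D with neighbour (fromℕ< 2≤n)
    ... | u , vu with far vu
    ...   | w , wv , wu with Rooted.long-path w vu (2≤D wv) (2≤D wu)
    ...     | P with far (linked P {1} (s≤s (s≤s z≤n)))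
    ...       | z , zx₁ , zx₂ with Rooted.far-end z P (2≤D zx₁) (2≤D zx₂)
    ...         | x , 4≤x = ≤-trans 4≤x (≤-diam D x z)

  no-dominating-edge⇒far : ¬ ∃₂ Dominating → ∀ {u v} → Adj T u v → ∃ λ w → Adj Tᶜ w u × Adj Tᶜ w v
  no-dominating-edge⇒far ¬dom {u} {v} uv
    with ¬∀⟶∃¬ n _ (λ w → near? w u ⊎-dec near? w v) (λ cover → ¬dom (u , v , uv , cover))
  ... | w , w∉ = w , (w∉ ∘ inj₁ ∘ inj₁ , w∉ ∘ inj₁ ∘ inj₂) , (w∉ ∘ inj₂ ∘ inj₁ , w∉ ∘ inj₂ ∘ inj₂)

  dichotomy : 2 ≤ n → (PWW d ≡ 6 × diam D ≡ 3) ⊎ (PWW d ≡ (n * n + 3 * n ∸ 4) / 2 × 3 < diam D)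
  dichotomy 2≤n with dominating?
  ... | yes (a , b , ab , cover) = inj₁ (PWW≡6 , diam-D)
    where open DominatingEdge ab cover
  ... | no ¬dom = inj₂ (PWW≡formula , 3<diam-D)
    where open NoDominatingEdge 2≤n (no-dominating-edge⇒far ¬dom)

pww-formula≢6 : ∀ n → (n * n + 3 * n ∸ 4) / 2 ≢ 6
pww-formula≢6 0 ()
pww-formula≢6 1 ()
pww-formula≢6 2 ()
pww-formula≢6 3 ()
pww-formula≢6 n@(suc (suc (suc (suc _)))) formula≡6 =
  1+n≰n (≤-trans (/-monoˡ-≤ 2 (≤-trans (m≤m+n 14 10) 24≤)) (≤-reflexive formula≡6))
  where
  4≤n : 4 ≤ n
  4≤n = s≤s (s≤s (s≤s (s≤s z≤n)))
  24≤ : 24 ≤ n * n + 3 * n ∸ 4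
  24≤ = ∸-monoˡ-≤ 4 (+-mono-≤ (*-mono-≤ 4≤n 4≤n) (*-monoʳ-≤ 3 4≤n))

-- Connectivity of T and of its complement is already implied by the existence of D and d.
mainTheorem12 : (n : ℕ) → 2 ≤ n → (T : Graph n) → IsTree T → Connected (complement T)
    → (d D : Fin n → Fin n → ℕ) → IsDistance (complement T) d → IsDistance T D
    → (PWW d ≡ 6 ⇔ diam D ≡ 3)
      × (PWW d ≡ (n * n + 3 * n ∸ 4) / 2 ⇔ 3 < diam D)
mainTheorem12 n 2≤n T (_ , acyclic) _ d D isd isD with TreeComplement.dichotomy T acyclic d D isd isD 2≤n
... | inj₁ (PWW≡6 , diam≡3) =
      mk⇔ (λ _ → diam≡3) (λ _ → PWW≡6)
    , mk⇔ (λ PWW≡formula → ⊥-elim (pww-formula≢6 n (trans (sym PWW≡formula) PWW≡6)))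
          (λ 3<diam → ⊥-elim (<-irrefl (sym diam≡3) 3<diam))
... | inj₂ (PWW≡formula , 3<diam) =
      mk⇔ (λ PWW≡6 → ⊥-elim (pww-formula≢6 n (trans (sym PWW≡formula) PWW≡6)))
          (λ diam≡3 → ⊥-elim (<-irrefl (sym diam≡3) 3<diam))
    , mk⇔ (λ _ → 3<diam) (λ _ → PWW≡formula)
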